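{- For $N\in \mathbb{N}$, we have \begin{align*} (a q)_N \sum_{n=1}^N \begin{bmatrix} N \\ n \end{bmatrix}_q \frac{(-1)^{n-1} n (q/e)_n (ae)^n q^{n(n-1)/2}}{(aq)_n}=\sum_{n=1}^{N}\begin{bmatrix} N \\ n \end{bmatrix}_q \frac{(ae)_{N-n} (q)_n (q/e)_n (ae)^n}{1-q^n}. \end{align*}
   Context: Let $q$ be a complex number with $|q|<1$, and $a,e$ complex numbers (with $e\neq 0$ and denominators nonzero). The $q$-Pochhammer symbol is $(x)_0=(x;q)_0=1$, $(x)_n=(x;q)_n=(1-x)(1-xq)\cdots(1-xq^{n-1})$ for $n\geq 1$, and $(x)_\infty=\lim_{n\to\infty}(x)_n$. The $q$-binomial coefficient is $\begin{bmatrix} N \\ n \end{bmatrix}_q=\frac{(q;q)_N}{(q;q)_n(q;q)_{N-n}}$ for $0\le n\le N$ and $0$ otherwise. -}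

module Defs where

open import Level using (Level; _⊔_; suc)
open import Data.Nat using (ℕ; _∸_; _≤?_)
import Data.Nat as N
open import Relation.Nullary using (¬_; yes; no)
open import Algebra.Bundles using (CommutativeRing)

-- A field: a commutative ring with 0 ≠ 1 in which every nonzero element
-- has a multiplicative inverse (the inverse function is total; its value
-- at 0 is irrelevant).
record Field (c ℓ : Level) : Set (suc (c ⊔ ℓ)) where
  field
    commutativeRing : CommutativeRing c ℓ
  open CommutativeRing commutativeRing public
  field
    _⁻¹      : Carrier → Carrier
    inverseʳ : ∀ x → ¬ (x ≈ 0#) → (x * (x ⁻¹)) ≈ 1#
    0≉1      : ¬ (0# ≈ 1#)

module FieldOps {c ℓ : Level} (F : Field c ℓ) where
  open Field F hiding (zero)

  infixl 7 _÷_
  _÷_ : Carrier → Carrier → Carrier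
  x ÷ y = x * (y ⁻¹)

  pow : Carrier → ℕ → Carrier
  pow x N.zero    = 1#
  pow x (N.suc n) = x * pow x n

  fromℕ : ℕ → Carrier
  fromℕ N.zero    = 0#
  fromℕ (N.suc n) = 1# + fromℕ n

  -- triangular number tri n = n(n-1)/2
  tri : ℕ → ℕ
  tri N.zero    = N.zero
  tri (N.suc n) = n N.+ tri n

  poch : Carrier → Carrier → ℕ → Carrier
  poch q x N.zero    = 1#
  poch q x (N.suc n) = poch q x n * (1# - x * pow q n)

  qbin : Carrier → ℕ → ℕ → Carrier
  qbin q M n with n ≤? M
  ... | yes _ = poch q q M ÷ (poch q q n * poch q q (M ∸ n))
  ... | no  _ = 0#

  sum1 : ℕ → (ℕ → Carrier) → Carrier
  sum1 N.zero    f = 0#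
  sum1 (N.suc M) f = sum1 M f + f (N.suc M)

{-# OPTIONS --safe #-}
-- Put b = q/e and c = ae, so that aq = bc. Since (aq)_N / (aq)_n = (bcq^n)_{N-n}, the two sides are
--   L_N(b) = Σ_n [N n] (-1)^{n-1} n (b)_n c^n q^{n(n-1)/2} (bcq^n)_{N-n}  and
--   R_N(b) = Σ_n [N n] (c)_{N-n} (q)_{n-1} (b)_n c^n.
-- Expanding [N+1 n] by q-Pascal and using (b)_{n+1} = (1-b)(bq)_n, every sum X of this shape obeys
--   X_{N+1}(b) = (1 - bcq^N) X_N(b) + (1 - b) c q^N Y_N(bq):
-- Y = -H for the alternating sum H_N(b) = Σ_n [N n] (-1)^n (b)_n c^n q^{n(n-1)/2} (bcq^n)_{N-n},
-- Y = H - L for L (as (-1)^n (n+1) = -(-1)^{n-1} n + (-1)^n), and Y = (c)_N - R for R.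
-- The first recurrence gives H_N(b) = (c)_N (q-Chu–Vandermonde); then L and R satisfy the same
-- recurrence with L_0 = R_0 = 0, so L = R by induction on N, for all b simultaneously.
module Submission where

open import Defs
open import Level using (Level)
open import Function using (_∘_)
open import Data.Nat as ℕ using (ℕ; zero; suc; _≤_; _<_; _∸_; z≤n; s≤s)
import Data.Nat.Properties as ℕ
open import Data.Integer as ℤ using (ℤ; +_; -[1+_]; _⊖_; _◃_; sign; ∣_∣)
import Data.Integer.Properties as ℤ
open import Data.Sign as Sign using (Sign)
open import Data.Maybe using (Maybe; just; nothing)
open import Data.Empty using (⊥-elim)
open import Data.Sum using (inj₁; inj₂)
open import Relation.Nullary using (¬_; yes; no)
open import Relation.Binary.PropositionalEquality as ≡ using (_≡_)
open import Algebra.Bundles using (CommutativeRing)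
open import Algebra.Solver.Ring.AlmostCommutativeRing
  using (AlmostCommutativeRing; _-Raw-AlmostCommutative⟶_; fromCommutativeRing)

-- The ring solver can only cancel (x - x ≈ 0) through a coefficient ring with
-- decidable equality mapped into the carrier; we use ℤ.
module IntegerCoefficientSolver {c ℓ : Level} (R : CommutativeRing c ℓ) where
  open CommutativeRing R
  open import Relation.Binary.Reasoning.Setoid setoid
  open import Algebra.Properties.Semiring.Mult.TCOptimised semiring
    using (_×_; 1+×; ×-homo-+; ×1-homo-*)
  open import Algebra.Properties.Ring ring using (-‿involutive; -0#≈0#; -1*x≈-x)
  open import Algebra.Properties.AbelianGroup +-abelianGroup using (⁻¹-∙-comm)

  -- The optimised multiple has 0 × x = 0# and 1 × x = x definitionally, so the
  -- solver's constants :0 and :1 below denote 0# and 1# on the nose.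
  ⟦_⟧ : ℤ → Carrier
  ⟦ + n ⟧      = n × 1#
  ⟦ -[1+ n ] ⟧ = - (suc n × 1#)

  [a+x]-[a+y]≈x-y : ∀ a x y → (a + x) - (a + y) ≈ x - y
  [a+x]-[a+y]≈x-y a x y = begin
    (a + x) - (a + y)     ≈⟨ +-congˡ (⁻¹-∙-comm a y) ⟨
    (a + x) + (- a - y)   ≈⟨ +-congʳ (+-comm a x) ⟩
    (x + a) + (- a - y)   ≈⟨ +-assoc x a _ ⟩
    x + (a + (- a - y))   ≈⟨ +-congˡ (+-assoc a (- a) (- y)) ⟨
    x + ((a - a) - y)     ≈⟨ +-congˡ (+-congʳ (-‿inverseʳ a)) ⟩
    x + (0# - y)          ≈⟨ +-congˡ (+-identityˡ (- y)) ⟩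
    x - y                 ∎

  ⊖-homo : ∀ m n → ⟦ m ⊖ n ⟧ ≈ m × 1# - n × 1#
  ⊖-homo m       zero    = sym (trans (+-congˡ -0#≈0#) (+-identityʳ _))
  ⊖-homo zero    (suc n) = sym (+-identityˡ _)
  ⊖-homo (suc m) (suc n) = begin
    ⟦ suc m ⊖ suc n ⟧              ≡⟨ ≡.cong ⟦_⟧ (ℤ.[1+m]⊖[1+n]≡m⊖n m n) ⟩
    ⟦ m ⊖ n ⟧                      ≈⟨ ⊖-homo m n ⟩
    m × 1# - n × 1#                ≈⟨ [a+x]-[a+y]≈x-y 1# _ _ ⟨
    (1# + m × 1#) - (1# + n × 1#)  ≈⟨ +-cong (1+× m 1#) (-‿cong (1+× n 1#)) ⟨
    suc m × 1# - suc n × 1#        ∎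

  +-homo : ∀ i j → ⟦ i ℤ.+ j ⟧ ≈ ⟦ i ⟧ + ⟦ j ⟧
  +-homo -[1+ m ] -[1+ n ] = begin
    - (suc (suc (m ℕ.+ n)) × 1#)   ≡⟨ ≡.cong (λ k → - (suc k × 1#)) (ℕ.+-suc m n) ⟨
    - ((suc m ℕ.+ suc n) × 1#)     ≈⟨ -‿cong (×-homo-+ 1# (suc m) (suc n)) ⟩
    - (suc m × 1# + suc n × 1#)    ≈⟨ ⁻¹-∙-comm _ _ ⟨
    ⟦ -[1+ m ] ⟧ + ⟦ -[1+ n ] ⟧    ∎
  +-homo -[1+ m ] (+ n)    = trans (⊖-homo n (suc m)) (+-comm _ _)
  +-homo (+ m)    -[1+ n ] = ⊖-homo m (suc n)
  +-homo (+ m)    (+ n)    = ×-homo-+ 1# m n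

  -‿homo : ∀ i → ⟦ ℤ.- i ⟧ ≈ - ⟦ i ⟧
  -‿homo -[1+ n ]    = sym (-‿involutive _)
  -‿homo (+ zero)    = sym -0#≈0#
  -‿homo (+ (suc n)) = refl

  ⟦_⟧ₛ : Sign → Carrier
  ⟦ Sign.+ ⟧ₛ = 1#
  ⟦ Sign.- ⟧ₛ = - 1#

  ◃-homo : ∀ s n → ⟦ s ◃ n ⟧ ≈ ⟦ s ⟧ₛ * n × 1#
  ◃-homo s      zero    = sym (zeroʳ _)
  ◃-homo Sign.+ (suc n) = sym (*-identityˡ _)
  ◃-homo Sign.- (suc n) = sym (-1*x≈-x _)

  *-homoₛ : ∀ s t → ⟦ s Sign.* t ⟧ₛ ≈ ⟦ s ⟧ₛ * ⟦ t ⟧ₛ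
  *-homoₛ Sign.+ t      = sym (*-identityˡ _)
  *-homoₛ Sign.- Sign.+ = sym (*-identityʳ _)
  *-homoₛ Sign.- Sign.- = sym (trans (-1*x≈-x _) (-‿involutive _))

  ⟦⟧≈sign*abs : ∀ i → ⟦ i ⟧ ≈ ⟦ sign i ⟧ₛ * ∣ i ∣ × 1#
  ⟦⟧≈sign*abs i = trans (reflexive (≡.cong ⟦_⟧ (≡.sym (ℤ.◃-inverse i)))) (◃-homo (sign i) ∣ i ∣)

  *-homo : ∀ i j → ⟦ i ℤ.* j ⟧ ≈ ⟦ i ⟧ * ⟦ j ⟧
  *-homo i j = begin
    ⟦ sign i Sign.* sign j ◃ ∣ i ∣ ℕ.* ∣ j ∣ ⟧
      ≈⟨ ◃-homo (sign i Sign.* sign j) (∣ i ∣ ℕ.* ∣ j ∣) ⟩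
    ⟦ sign i Sign.* sign j ⟧ₛ * (∣ i ∣ ℕ.* ∣ j ∣) × 1#
      ≈⟨ *-cong (*-homoₛ (sign i) (sign j)) (×1-homo-* ∣ i ∣ ∣ j ∣) ⟩
    (⟦ sign i ⟧ₛ * ⟦ sign j ⟧ₛ) * (∣ i ∣ × 1# * ∣ j ∣ × 1#)
      ≈⟨ interchange _ _ _ _ ⟩
    (⟦ sign i ⟧ₛ * ∣ i ∣ × 1#) * (⟦ sign j ⟧ₛ * ∣ j ∣ × 1#)
      ≈⟨ *-cong (⟦⟧≈sign*abs i) (⟦⟧≈sign*abs j) ⟨
    ⟦ i ⟧ * ⟦ j ⟧                                  ∎
    where open import Algebra.Properties.CommutativeSemigroup *-commutativeSemigroup using (interchange)

  ring′ : AlmostCommutativeRing c ℓ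
  ring′ = fromCommutativeRing R

  homomorphism : ℤ.+-*-rawRing -Raw-AlmostCommutative⟶ ring′
  homomorphism = record
    { ⟦_⟧ = ⟦_⟧ ; +-homo = +-homo ; *-homo = *-homo ; -‿homo = -‿homo
    ; 0-homo = refl ; 1-homo = refl }

  ⟦⟧-≟ : ∀ i j → Maybe (⟦ i ⟧ ≈ ⟦ j ⟧)
  ⟦⟧-≟ i j with i ℤ.≟ j
  ... | yes ≡.refl = just refl
  ... | no _       = nothing

  open import Algebra.Solver.Ring ℤ.+-*-rawRing ring′ homomorphism ⟦⟧-≟ public
    using (Polynomial; solve; _:=_; con; _:+_; _:*_; _:-_; :-_)

  :0 :1 : ∀ {n} → Polynomial n
  :0 = con (+ 0)
  :1 = con (+ 1)

module QSeries {a ℓ : Level} (F : Field a ℓ) where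
  open Field F hiding (zero)
  open FieldOps F
  open IntegerCoefficientSolver commutativeRing
  open import Relation.Binary.Reasoning.Setoid setoid

  *-≉0 : ∀ {x y} → ¬ x ≈ 0# → ¬ y ≈ 0# → ¬ x * y ≈ 0#
  *-≉0 {x} {y} x≉0 y≉0 xy≈0 = y≉0 (begin
    y                ≈⟨ *-identityˡ y ⟨
    1# * y           ≈⟨ *-congʳ (inverseʳ x x≉0) ⟨
    x * x ⁻¹ * y     ≈⟨ trans (*-congʳ (*-comm x (x ⁻¹))) (*-assoc _ _ _) ⟩
    x ⁻¹ * (x * y)   ≈⟨ *-congˡ xy≈0 ⟩
    x ⁻¹ * 0#        ≈⟨ zeroʳ _ ⟩
    0#               ∎)

  *-÷-cancelʳ : ∀ x {y} → ¬ y ≈ 0# → x * y ÷ y ≈ x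
  *-÷-cancelʳ x {y} y≉0 = begin
    x * y * y ⁻¹     ≈⟨ *-assoc x y (y ⁻¹) ⟩
    x * (y * y ⁻¹)   ≈⟨ *-congˡ (inverseʳ y y≉0) ⟩
    x * 1#           ≈⟨ *-identityʳ x ⟩
    x                ∎

  pow-+ : ∀ x m n → pow x (m ℕ.+ n) ≈ pow x m * pow x n
  pow-+ x zero    n = sym (*-identityˡ _)
  pow-+ x (suc m) n = trans (*-congˡ (pow-+ x m n)) (sym (*-assoc _ _ _))

  pow-∸ : ∀ x {m n} → m ≤ n → pow x m * pow x (n ∸ m) ≈ pow x n
  pow-∸ x {m} m≤n = trans (sym (pow-+ x m _)) (reflexive (≡.cong (pow x) (ℕ.m+[n∸m]≡n m≤n)))

  sum0 : ℕ → (ℕ → Carrier) → Carrier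
  sum0 zero    f = f 0
  sum0 (suc N) f = sum0 N f + f (suc N)

  sum0-cong : ∀ N {f g} → (∀ k → k ≤ N → f k ≈ g k) → sum0 N f ≈ sum0 N g
  sum0-cong zero    f≈g = f≈g 0 z≤n
  sum0-cong (suc N) f≈g =
    +-cong (sum0-cong N (λ k k≤N → f≈g k (ℕ.m≤n⇒m≤1+n k≤N))) (f≈g (suc N) ℕ.≤-refl)

  sum0-+ : ∀ N f g → sum0 N (λ k → f k + g k) ≈ sum0 N f + sum0 N g
  sum0-+ zero    f g = refl
  sum0-+ (suc N) f g = trans (+-congʳ (sum0-+ N f g))
    (solve 4 (λ x y u v → x :+ y :+ (u :+ v) := x :+ u :+ (y :+ v)) refl _ _ _ _)

  *-distribˡ-sum0 : ∀ N x f → x * sum0 N f ≈ sum0 N (λ k → x * f k)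
  *-distribˡ-sum0 zero    x f = refl
  *-distribˡ-sum0 (suc N) x f = trans (distribˡ x _ _) (+-congʳ (*-distribˡ-sum0 N x f))

  sum0-suc : ∀ N f → sum0 (suc N) f ≈ f 0 + sum0 N (f ∘ suc)
  sum0-suc zero    f = refl
  sum0-suc (suc N) f = trans (+-congʳ (sum0-suc N f)) (+-assoc _ _ _)

  sum0≈sum1 : ∀ N f → f 0 ≈ 0# → sum0 N f ≈ sum1 N f
  sum0≈sum1 zero    f f₀≈0 = f₀≈0
  sum0≈sum1 (suc N) f f₀≈0 = +-congʳ (sum0≈sum1 N f f₀≈0)

  δ₀ : Carrier → ℕ → Carrier
  δ₀ x zero    = x
  δ₀ x (suc _) = 0#

  sum0-*-δ₀ : ∀ N (f : ℕ → Carrier) x → sum0 N (λ k → f k * δ₀ x k) ≈ f 0 * x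
  sum0-*-δ₀ zero    f x = refl
  sum0-*-δ₀ (suc N) f x = trans (+-cong (sum0-*-δ₀ N f x) (zeroʳ _)) (+-identityʳ _)

  sum1-cong : ∀ N {f g} → (∀ k → 1 ≤ k → k ≤ N → f k ≈ g k) → sum1 N f ≈ sum1 N g
  sum1-cong zero    f≈g = refl
  sum1-cong (suc N) f≈g =
    +-cong (sum1-cong N (λ k 1≤k k≤N → f≈g k 1≤k (ℕ.m≤n⇒m≤1+n k≤N)))
           (f≈g (suc N) (s≤s z≤n) ℕ.≤-refl)

  *-distribˡ-sum1 : ∀ N x f → x * sum1 N f ≈ sum1 N (λ k → x * f k)
  *-distribˡ-sum1 zero    x f = zeroʳ x
  *-distribˡ-sum1 (suc N) x f = trans (distribˡ x _ _) (+-congʳ (*-distribˡ-sum1 N x f))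

  module QCalculus (q : Carrier) where

    poch-cong : ∀ {x y} n → x ≈ y → poch q x n ≈ poch q y n
    poch-cong zero    x≈y = refl
    poch-cong (suc n) x≈y = *-cong (poch-cong n x≈y) (+-congˡ (-‿cong (*-congʳ x≈y)))

    poch-+ : ∀ x m n → poch q x (m ℕ.+ n) ≈ poch q x m * poch q (x * pow q m) n
    poch-+ x m zero    = trans (reflexive (≡.cong (poch q x) (ℕ.+-identityʳ m))) (sym (*-identityʳ _))
    poch-+ x m (suc n) = begin
      poch q x (m ℕ.+ suc n)
        ≡⟨ ≡.cong (poch q x) (ℕ.+-suc m n) ⟩
      poch q x (m ℕ.+ n) * (1# - x * pow q (m ℕ.+ n))
        ≈⟨ *-cong (poch-+ x m n) (+-congˡ (-‿cong (*-congˡ (pow-+ q m n)))) ⟩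
      poch q x m * poch q (x * pow q m) n * (1# - x * (pow q m * pow q n))
        ≈⟨ solve 5 (λ A B x u v → A :* B :* (:1 :- x :* (u :* v)) := A :* (B :* (:1 :- x :* u :* v)))
             refl _ _ x _ _ ⟩
      poch q x m * poch q (x * pow q m) (suc n) ∎

    poch-suc : ∀ x n → poch q x (suc n) ≈ (1# - x) * poch q (x * q) n
    poch-suc x n = begin
      poch q x (1 ℕ.+ n)               ≈⟨ poch-+ x 1 n ⟩
      1# * (1# - x * 1#) * poch q (x * (q * 1#)) n
        ≈⟨ *-cong (solve 1 (λ x → :1 :* (:1 :- x :* :1) := :1 :- x) refl x)
                  (poch-cong n (*-congˡ (*-identityʳ q))) ⟩
      (1# - x) * poch q (x * q) n      ∎

    poch-suc-∸ : ∀ x {k N} → k ≤ N → poch q x (suc N ∸ k) ≈ poch q x (N ∸ k) * (1# - x * pow q (N ∸ k))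
    poch-suc-∸ x k≤N = reflexive (≡.cong (poch q x) (ℕ.+-∸-assoc 1 k≤N))

    poch≉0 : ∀ x n → (∀ k → k < n → ¬ (1# - x * pow q k) ≈ 0#) → ¬ poch q x n ≈ 0#
    poch≉0 x zero    factors≉0 1≈0 = 0≉1 (sym 1≈0)
    poch≉0 x (suc n) factors≉0 =
      *-≉0 (poch≉0 x n (λ k k<n → factors≉0 k (ℕ.m≤n⇒m≤1+n k<n))) (factors≉0 n ℕ.≤-refl)

    poch-*-÷-poch : ∀ x y {n N} → n ≤ N → ¬ poch q x n ≈ 0# →
                    poch q x N * (y ÷ poch q x n) ≈ y * poch q (x * pow q n) (N ∸ n)
    poch-*-÷-poch x y {n} {N} n≤N xₙ≉0 = begin
      poch q x N * (y ÷ A)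
        ≡⟨ ≡.cong (λ m → poch q x m * (y ÷ A)) (ℕ.m+[n∸m]≡n n≤N) ⟨
      poch q x (n ℕ.+ (N ∸ n)) * (y ÷ A)   ≈⟨ *-congʳ (poch-+ x n (N ∸ n)) ⟩
      A * B * (y * A ⁻¹)
        ≈⟨ solve 4 (λ A B y A⁻¹ → A :* B :* (y :* A⁻¹) := y :* B :* A :* A⁻¹) refl A B y (A ⁻¹) ⟩
      y * B * A ÷ A                        ≈⟨ *-÷-cancelʳ (y * B) xₙ≉0 ⟩
      y * B                                ∎
      where
      A B : Carrier
      A = poch q x n
      B = poch q (x * pow q n) (N ∸ n)

    -- Gaussian binomial coefficient, defined by the q-Pascal rule so that no division occurs.
    qbinom : ℕ → ℕ → Carrier
    qbinom N       zero    = 1#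
    qbinom zero    (suc k) = 0#
    qbinom (suc N) (suc k) = qbinom N (suc k) + pow q (N ∸ k) * qbinom N k

    qbinom-> : ∀ {N k} → N < k → qbinom N k ≈ 0#
    qbinom-> {zero}  {suc k} _           = refl
    qbinom-> {suc N} {suc k} (s≤s N<k) =
      trans (+-cong (qbinom-> (ℕ.m≤n⇒m≤1+n N<k)) (trans (*-congˡ (qbinom-> N<k)) (zeroʳ _)))
            (+-identityʳ 0#)

    qbinom-*-poch : ∀ {N n} → n ≤ N → qbinom N n * (poch q q n * poch q q (N ∸ n)) ≈ poch q q N
    qbinom-*-poch {N}     {zero}  _         = trans (*-identityˡ _) (*-identityˡ _)
    qbinom-*-poch {suc N} {suc k} (s≤s k≤N) = begin
      (qbinom N (suc k) + pow q (N ∸ k) * qbinom N k) * (poch q q k * (1# - q * pow q k) * poch q q (N ∸ k))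
        ≈⟨ solve 6 (λ A u B Pk v Pm → (A :+ u :* B) :* (Pk :* (:1 :- v) :* Pm)
                                    := A :* (Pk :* (:1 :- v) :* Pm) :+ u :* (:1 :- v) :* (B :* (Pk :* Pm)))
             refl _ _ _ _ (q * pow q k) _ ⟩
      qbinom N (suc k) * (poch q q (suc k) * poch q q (N ∸ k))
        + pow q (N ∸ k) * (1# - q * pow q k) * (qbinom N k * (poch q q k * poch q q (N ∸ k)))
        ≈⟨ +-cong firstTerm (*-congˡ (qbinom-*-poch k≤N)) ⟩
      (1# - pow q (N ∸ k)) * poch q q N + pow q (N ∸ k) * (1# - q * pow q k) * poch q q N
        ≈⟨ solve 4 (λ u v w P → (:1 :- u) :* P :+ u :* (:1 :- v :* w) :* P := P :* (:1 :- v :* (w :* u)))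
             refl _ q _ _ ⟩
      poch q q N * (1# - q * (pow q k * pow q (N ∸ k)))
        ≈⟨ *-congˡ (+-congˡ (-‿cong (*-congˡ (pow-∸ q k≤N)))) ⟩
      poch q q (suc N) ∎
      where
      firstTerm : qbinom N (suc k) * (poch q q (suc k) * poch q q (N ∸ k)) ≈ (1# - pow q (N ∸ k)) * poch q q N
      firstTerm with ℕ.m≤n⇒m<n∨m≡n k≤N
      ... | inj₂ ≡.refl = begin
        qbinom N (suc N) * (poch q q (suc N) * poch q q (N ∸ N))
          ≈⟨ trans (*-congʳ (qbinom-> {N} {suc N} ℕ.≤-refl)) (zeroˡ _) ⟩
        0#                                  ≈⟨ zeroˡ _ ⟨
        0# * poch q q N                     ≈⟨ *-congʳ (-‿inverseʳ 1#) ⟨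
        (1# - 1#) * poch q q N              ≡⟨ ≡.cong (λ m → (1# - pow q m) * poch q q N) (ℕ.n∸n≡0 N) ⟨
        (1# - pow q (N ∸ N)) * poch q q N   ∎
      ... | inj₁ k<N rewrite ℕ.+-∸-assoc 1 k<N = begin
        qbinom N (suc k) * (poch q q (suc k) * (poch q q m * (1# - q * pow q m)))
          ≈⟨ solve 4 (λ A P Q v → A :* (P :* (Q :* (:1 :- v))) := (:1 :- v) :* (A :* (P :* Q)))
               refl _ _ _ (q * pow q m) ⟩
        (1# - q * pow q m) * (qbinom N (suc k) * (poch q q (suc k) * poch q q m))
          ≈⟨ *-congˡ (qbinom-*-poch k<N) ⟩
        (1# - q * pow q m) * poch q q N ∎
        where
        m : ℕ
        m = N ∸ suc k

    qbin≈qbinom : ∀ {N n} → (∀ k → 1 ≤ k → k ≤ N → ¬ (1# - pow q k) ≈ 0#) → n ≤ N →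
                  qbin q N n ≈ qbinom N n
    qbin≈qbinom {N} {n} qᵏ≉1 n≤N with n ℕ.≤? N
    ... | no n≰N = ⊥-elim (n≰N n≤N)
    ... | yes _  = begin
      poch q q N ÷ D          ≈⟨ *-congʳ (qbinom-*-poch n≤N) ⟨
      qbinom N n * D ÷ D      ≈⟨ *-÷-cancelʳ _ (*-≉0 (qpoch≉0 n≤N) (qpoch≉0 (ℕ.m∸n≤m N n))) ⟩
      qbinom N n              ∎
      where
      D : Carrier
      D = poch q q n * poch q q (N ∸ n)
      qpoch≉0 : ∀ {m} → m ≤ N → ¬ poch q q m ≈ 0#
      qpoch≉0 m≤N = poch≉0 q _ (λ k k<m → qᵏ≉1 (suc k) (s≤s z≤n) (ℕ.≤-trans k<m m≤N))

    binomialSum : ℕ → (ℕ → Carrier) → Carrier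
    binomialSum N Y = sum0 N (λ n → qbinom N n * Y n)

    binomialSum-+ : ∀ N Y Z → binomialSum N (λ n → Y n + Z n) ≈ binomialSum N Y + binomialSum N Z
    binomialSum-+ N Y Z = trans (sum0-cong N (λ n _ → distribˡ (qbinom N n) (Y n) (Z n)))
                                (sum0-+ N (λ n → qbinom N n * Y n) (λ n → qbinom N n * Z n))

    binomialSum-scale : ∀ N x Y → binomialSum N (λ n → x * Y n) ≈ x * binomialSum N Y
    binomialSum-scale N x Y = begin
      sum0 N (λ n → qbinom N n * (x * Y n))
        ≈⟨ sum0-cong N (λ n _ → solve 3 (λ A x y → A :* (x :* y) := x :* (A :* y)) refl _ x _) ⟩
      sum0 N (λ n → x * (qbinom N n * Y n))   ≈⟨ *-distribˡ-sum0 N x _ ⟨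
      x * binomialSum N Y                      ∎

    binomialSum-δ₀ : ∀ N x → binomialSum N (δ₀ x) ≈ x
    binomialSum-δ₀ N x = trans (sum0-*-δ₀ N (qbinom N) x) (*-identityˡ x)

    binomialSum-pascal : ∀ N (Y : ℕ → Carrier) →
      binomialSum (suc N) Y ≈ binomialSum N (λ k → Y k + pow q (N ∸ k) * Y (suc k))
    binomialSum-pascal N Y = begin
      sum0 (suc N) (λ n → qbinom (suc N) n * Y n)
        ≈⟨ sum0-suc N (λ n → qbinom (suc N) n * Y n) ⟩
      1# * Y 0 + sum0 N (λ k → (qbinom N (suc k) + pow q (N ∸ k) * qbinom N k) * Y (suc k))
        ≈⟨ +-congˡ (trans (sum0-cong N (λ k _ → distribʳ _ _ _))
                          (sum0-+ N (λ k → qbinom N (suc k) * Y (suc k)) shifted)) ⟩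
      1# * Y 0 + (sum0 N (λ k → qbinom N (suc k) * Y (suc k)) + sum0 N shifted)
        ≈⟨ +-assoc _ _ _ ⟨
      1# * Y 0 + sum0 N (λ k → qbinom N (suc k) * Y (suc k)) + sum0 N shifted
        ≈⟨ +-congʳ (sum0-suc N (λ k → qbinom N k * Y k)) ⟨
      binomialSum N Y + qbinom N (suc N) * Y (suc N) + sum0 N shifted
        ≈⟨ +-congʳ (trans (+-congˡ (trans (*-congʳ (qbinom-> {N} {suc N} ℕ.≤-refl)) (zeroˡ _)))
                          (+-identityʳ _)) ⟩
      binomialSum N Y + sum0 N shifted
        ≈⟨ sum0-+ N (λ k → qbinom N k * Y k) shifted ⟨
      sum0 N (λ k → qbinom N k * Y k + shifted k)
        ≈⟨ sum0-cong N (λ k _ → solve 4 (λ A y u y′ → A :* y :+ u :* A :* y′ := A :* (y :+ u :* y′))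
                                         refl _ _ _ _) ⟩
      binomialSum N (λ k → Y k + pow q (N ∸ k) * Y (suc k)) ∎
      where
      shifted : ℕ → Carrier
      shifted k = pow q (N ∸ k) * qbinom N k * Y (suc k)

    module Recurrence (c : Carrier) where

      step : ℕ → Carrier → Carrier → Carrier → Carrier
      step N b x y = (1# - b * c * pow q N) * x + (1# - b) * c * pow q N * y

      step-cong : ∀ N b {x x′ y y′} → x ≈ x′ → y ≈ y′ → step N b x y ≈ step N b x′ y′
      step-cong N b x≈x′ y≈y′ = +-cong (*-congˡ x≈x′) (*-congˡ y≈y′)

      binomialSum-step : ∀ N b (Y : ℕ → ℕ → Carrier) (Z : ℕ → Carrier) →
        (∀ k → k ≤ N → Y (suc N) k + pow q (N ∸ k) * Y (suc N) (suc k) ≈ step N b (Y N k) (Z k)) →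
        binomialSum (suc N) (Y (suc N)) ≈ step N b (binomialSum N (Y N)) (binomialSum N Z)
      binomialSum-step N b Y Z termwise = begin
        binomialSum (suc N) (Y (suc N))
          ≈⟨ binomialSum-pascal N (Y (suc N)) ⟩
        binomialSum N (λ k → Y (suc N) k + pow q (N ∸ k) * Y (suc N) (suc k))
          ≈⟨ sum0-cong N (λ k k≤N → *-congˡ (termwise k k≤N)) ⟩
        binomialSum N (λ k → u * Y N k + v * Z k)
          ≈⟨ binomialSum-+ N (λ k → u * Y N k) (λ k → v * Z k) ⟩
        binomialSum N (λ k → u * Y N k) + binomialSum N (λ k → v * Z k)
          ≈⟨ +-cong (binomialSum-scale N u (Y N)) (binomialSum-scale N v Z) ⟩
        step N b (binomialSum N (Y N)) (binomialSum N Z) ∎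
        where
        u v : Carrier
        u = 1# - b * c * pow q N
        v = (1# - b) * c * pow q N

      weightedTerm : (ℕ → Carrier) → Carrier → ℕ → ℕ → Carrier
      weightedTerm w b N n = w n * poch q b n * pow c n * pow q (tri n) * poch q (b * c * pow q n) (N ∸ n)

      weightedTerm-step : ∀ w b N k → k ≤ N →
        weightedTerm w b (suc N) k + pow q (N ∸ k) * weightedTerm w b (suc N) (suc k)
          ≈ step N b (weightedTerm w b N k) (weightedTerm (w ∘ suc) (b * q) N k)
      weightedTerm-step w b N k k≤N = begin
        w k * B * C * T * poch q (b * c * v) (suc N ∸ k)
          + u * (w (suc k) * poch q b (suc k) * (c * C) * pow q (k ℕ.+ tri k) * poch q (b * c * (q * v)) (N ∸ k))
          ≈⟨ +-cong (*-congˡ (poch-suc-∸ (b * c * v) k≤N))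
                    (*-congˡ (*-cong (*-cong (*-congʳ (*-congˡ (poch-suc b k))) (pow-+ q k (tri k)))
                                     (poch-cong (N ∸ k) bcq≈bqc))) ⟩
        w k * B * C * T * (P * (1# - b * c * v * u))
          + u * (w (suc k) * ((1# - b) * B′) * (c * C) * (v * T) * P′)
          ≈⟨ solve 12 (λ w B C T P b c v u w′ B′ P′ →
                 w :* B :* C :* T :* (P :* (:1 :- b :* c :* v :* u))
                   :+ u :* (w′ :* ((:1 :- b) :* B′) :* (c :* C) :* (v :* T) :* P′)
              := (:1 :- b :* c :* (v :* u)) :* (w :* B :* C :* T :* P)
                   :+ (:1 :- b) :* c :* (v :* u) :* (w′ :* B′ :* C :* T :* P′))
              refl (w k) B C T P b c v u (w (suc k)) B′ P′ ⟩
        (1# - b * c * (v * u)) * (w k * B * C * T * P)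
          + (1# - b) * c * (v * u) * (w (suc k) * B′ * C * T * P′)
          ≈⟨ +-cong (*-congʳ (+-congˡ (-‿cong (*-congˡ qᴺ)))) (*-congʳ (*-congˡ qᴺ)) ⟩
        step N b (weightedTerm w b N k) (weightedTerm (w ∘ suc) (b * q) N k) ∎
        where
        B B′ C T u v P P′ : Carrier
        B  = poch q b k
        B′ = poch q (b * q) k
        C  = pow c k
        T  = pow q (tri k)
        u  = pow q (N ∸ k)
        v  = pow q k
        P  = poch q (b * c * v) (N ∸ k)
        P′ = poch q (b * q * c * v) (N ∸ k)
        qᴺ : v * u ≈ pow q N
        qᴺ = pow-∸ q k≤N
        bcq≈bqc : b * c * (q * v) ≈ b * q * c * v
        bcq≈bqc = solve 4 (λ b c q v → b :* c :* (q :* v) := b :* q :* c :* v) refl b c q v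

      weightedSum : (ℕ → Carrier) → Carrier → ℕ → Carrier
      weightedSum w b N = binomialSum N (weightedTerm w b N)

      weightedSum-step : ∀ w b N →
        weightedSum w b (suc N) ≈ step N b (weightedSum w b N) (weightedSum (w ∘ suc) (b * q) N)
      weightedSum-step w b N =
        binomialSum-step N b (weightedTerm w b) (weightedTerm (w ∘ suc) (b * q) N) (weightedTerm-step w b N)

      weightedSum-cong : ∀ {w w′} b N → (∀ n → w n ≈ w′ n) → weightedSum w b N ≈ weightedSum w′ b N
      weightedSum-cong b N w≈w′ =
        sum0-cong N (λ n _ → *-congˡ (*-congʳ (*-congʳ (*-congʳ (*-congʳ (w≈w′ n))))))

      weightedSum-+ : ∀ w w′ b N →
        weightedSum (λ n → w n + w′ n) b N ≈ weightedSum w b N + weightedSum w′ b N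
      weightedSum-+ w w′ b N =
        trans (sum0-cong N (λ n _ → *-congˡ (solve 6 (λ w w′ B C T P → (w :+ w′) :* B :* C :* T :* P
                                                         := w :* B :* C :* T :* P :+ w′ :* B :* C :* T :* P)
                                                  refl _ _ _ _ _ _)))
              (binomialSum-+ N (weightedTerm w b N) (weightedTerm w′ b N))

      weightedSum-scale : ∀ x w b N → weightedSum (λ n → x * w n) b N ≈ x * weightedSum w b N
      weightedSum-scale x w b N =
        trans (sum0-cong N (λ n _ → *-congˡ (solve 6 (λ x w B C T P → x :* w :* B :* C :* T :* P
                                                         := x :* (w :* B :* C :* T :* P))
                                                  refl x _ _ _ _ _)))
              (binomialSum-scale N x (weightedTerm w b N))

      alternating : ℕ → Carrier
      alternating n = pow (- 1#) n

      poch-step : ∀ N b → poch q c (suc N) ≈ step N b (poch q c N) (- 1# * poch q c N)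
      poch-step N b = solve 4 (λ P b c v → P :* (:1 :- c :* v)
                                         := (:1 :- b :* c :* v) :* P :+ (:1 :- b) :* c :* v :* (:- :1 :* P))
                        refl (poch q c N) b c (pow q N)

      alternatingSum≈poch : ∀ N b → weightedSum alternating b N ≈ poch q c N
      alternatingSum≈poch zero    b = solve 0 (:1 :* (:1 :* :1 :* :1 :* :1 :* :1) := :1) refl
      alternatingSum≈poch (suc N) b = begin
        weightedSum alternating b (suc N)
          ≈⟨ weightedSum-step alternating b N ⟩
        step N b (weightedSum alternating b N) (weightedSum (λ n → - 1# * alternating n) (b * q) N)
          ≈⟨ step-cong N b (alternatingSum≈poch N b)
                           (trans (weightedSum-scale (- 1#) alternating (b * q) N)
                                  (*-congˡ (alternatingSum≈poch N (b * q)))) ⟩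
        step N b (poch q c N) (- 1# * poch q c N)
          ≈⟨ poch-step N b ⟨
        poch q c (suc N) ∎

      signedIndex : ℕ → Carrier
      signedIndex n = pow (- 1#) (n ∸ 1) * fromℕ n

      signedIndex-suc : ∀ n → signedIndex (suc n) ≈ - 1# * signedIndex n + alternating n
      signedIndex-suc zero    = solve 0 (:1 :* (:1 :+ :0) := :- :1 :* (:1 :* :0) :+ :1) refl
      signedIndex-suc (suc n) = solve 2 (λ s f → :- :1 :* s :* (:1 :+ f) := :- :1 :* (s :* f) :+ :- :1 :* s)
                                  refl (pow (- 1#) n) (fromℕ (suc n))

      signedIndexSum-step : ∀ b N →
        weightedSum signedIndex b (suc N)
          ≈ step N b (weightedSum signedIndex b N)
                     (- 1# * weightedSum signedIndex (b * q) N + weightedSum alternating (b * q) N)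
      signedIndexSum-step b N = begin
        weightedSum signedIndex b (suc N)
          ≈⟨ weightedSum-step signedIndex b N ⟩
        step N b (weightedSum signedIndex b N) (weightedSum (signedIndex ∘ suc) (b * q) N)
          ≈⟨ step-cong N b refl (begin
               weightedSum (signedIndex ∘ suc) (b * q) N
                 ≈⟨ weightedSum-cong (b * q) N signedIndex-suc ⟩
               weightedSum (λ n → - 1# * signedIndex n + alternating n) (b * q) N
                 ≈⟨ weightedSum-+ (λ n → - 1# * signedIndex n) alternating (b * q) N ⟩
               weightedSum (λ n → - 1# * signedIndex n) (b * q) N + weightedSum alternating (b * q) N
                 ≈⟨ +-congʳ (weightedSum-scale (- 1#) signedIndex (b * q) N) ⟩
               - 1# * weightedSum signedIndex (b * q) N + weightedSum alternating (b * q) N ∎) ⟩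
        step N b (weightedSum signedIndex b N)
                 (- 1# * weightedSum signedIndex (b * q) N + weightedSum alternating (b * q) N) ∎

      -- (q;q)_{n-1}, set to 0 at n = 0 so that the n = 0 term of the right-hand sum vanishes.
      qpochPred : ℕ → Carrier
      qpochPred zero    = 0#
      qpochPred (suc n) = poch q q n

      rhsTerm : Carrier → ℕ → ℕ → Carrier
      rhsTerm b N n = poch q c (N ∸ n) * qpochPred n * poch q b n * pow c n

      rhsSum : Carrier → ℕ → Carrier
      rhsSum b N = binomialSum N (rhsTerm b N)

      rhsTerm-step : ∀ b N k → k ≤ N →
        rhsTerm b (suc N) k + pow q (N ∸ k) * rhsTerm b (suc N) (suc k)
          ≈ step N b (rhsTerm b N k) (- 1# * rhsTerm (b * q) N k + δ₀ (poch q c N) k)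
      rhsTerm-step b N zero    _ =
        solve 5 (λ P′ P b c v →
            P′ :* :0 :* :1 :* :1 :+ v :* (P :* :1 :* (:1 :* (:1 :- b :* :1)) :* (c :* :1))
          := (:1 :- b :* c :* v) :* (P :* :0 :* :1 :* :1)
               :+ (:1 :- b) :* c :* v :* (:- :1 :* (P :* :0 :* :1 :* :1) :+ P))
          refl (poch q c (suc N)) (poch q c N) b c (pow q N)
      rhsTerm-step b N (suc j) j<N = begin
        poch q c (N ∸ j) * Q * poch q b (suc j) * C
          + u * (P * (Q * (1# - v)) * (poch q b (suc j) * (1# - b * v)) * (c * C))
          ≈⟨ +-cong (*-congʳ (*-cong (*-congʳ (poch-suc-∸ c j<N)) B≈))
                    (*-congˡ (*-congʳ (*-congˡ (*-congʳ B≈)))) ⟩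
        P * (1# - c * u) * Q * ((1# - b) * B′) * C
          + u * (P * (Q * (1# - v)) * ((1# - b) * B′ * (1# - b * v)) * (c * C))
          ≈⟨ solve 9 (λ P c u Q b B′ C q w →
                 P :* (:1 :- c :* u) :* Q :* ((:1 :- b) :* B′) :* C
                   :+ u :* (P :* (Q :* (:1 :- q :* w)) :* ((:1 :- b) :* B′ :* (:1 :- b :* (q :* w))) :* (c :* C))
              := (:1 :- b :* c :* (q :* w :* u)) :* (P :* Q :* ((:1 :- b) :* B′) :* C)
                   :+ (:1 :- b) :* c :* (q :* w :* u) :* (:- :1 :* (P :* Q :* (B′ :* (:1 :- b :* q :* w)) :* C) :+ :0))
              refl P c u Q b B′ C q (pow q j) ⟩
        (1# - b * c * (v * u)) * (P * Q * ((1# - b) * B′) * C)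
          + (1# - b) * c * (v * u) * (- 1# * (P * Q * poch q (b * q) (suc j) * C) + 0#)
          ≈⟨ +-cong (*-cong (+-congˡ (-‿cong (*-congˡ qᴺ))) (*-congʳ (*-congˡ (sym B≈))))
                    (*-congʳ (*-congˡ qᴺ)) ⟩
        step N b (rhsTerm b N (suc j)) (- 1# * rhsTerm (b * q) N (suc j) + 0#) ∎
        where
        P Q B′ C u v : Carrier
        P  = poch q c (N ∸ suc j)
        Q  = poch q q j
        B′ = poch q (b * q) j
        C  = pow c (suc j)
        u  = pow q (N ∸ suc j)
        v  = q * pow q j
        B≈ : poch q b (suc j) ≈ (1# - b) * B′
        B≈ = poch-suc b j
        qᴺ : v * u ≈ pow q N
        qᴺ = pow-∸ q j<N

      rhsSum-step : ∀ b N → rhsSum b (suc N) ≈ step N b (rhsSum b N) (- 1# * rhsSum (b * q) N + poch q c N)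
      rhsSum-step b N = begin
        rhsSum b (suc N)
          ≈⟨ binomialSum-step N b (rhsTerm b) (λ k → - 1# * rhsTerm (b * q) N k + δ₀ (poch q c N) k)
                              (rhsTerm-step b N) ⟩
        step N b (rhsSum b N) (binomialSum N (λ k → - 1# * rhsTerm (b * q) N k + δ₀ (poch q c N) k))
          ≈⟨ step-cong N b refl (begin
               binomialSum N (λ k → - 1# * rhsTerm (b * q) N k + δ₀ (poch q c N) k)
                 ≈⟨ binomialSum-+ N (λ k → - 1# * rhsTerm (b * q) N k) (δ₀ (poch q c N)) ⟩
               binomialSum N (λ k → - 1# * rhsTerm (b * q) N k) + binomialSum N (δ₀ (poch q c N))
                 ≈⟨ +-cong (binomialSum-scale N (- 1#) (rhsTerm (b * q) N))
                           (binomialSum-δ₀ N (poch q c N)) ⟩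
               - 1# * rhsSum (b * q) N + poch q c N ∎) ⟩
        step N b (rhsSum b N) (- 1# * rhsSum (b * q) N + poch q c N) ∎

      signedIndexSum≈rhsSum : ∀ N b → weightedSum signedIndex b N ≈ rhsSum b N
      signedIndexSum≈rhsSum zero    b =
        solve 0 (:1 :* (:1 :* :0 :* :1 :* :1 :* :1 :* :1) := :1 :* (:1 :* :0 :* :1 :* :1)) refl
      signedIndexSum≈rhsSum (suc N) b = begin
        weightedSum signedIndex b (suc N)
          ≈⟨ signedIndexSum-step b N ⟩
        step N b (weightedSum signedIndex b N)
                 (- 1# * weightedSum signedIndex (b * q) N + weightedSum alternating (b * q) N)
          ≈⟨ step-cong N b (signedIndexSum≈rhsSum N b)
                           (+-cong (*-congˡ (signedIndexSum≈rhsSum N (b * q))) (alternatingSum≈poch N (b * q))) ⟩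
        step N b (rhsSum b N) (- 1# * rhsSum (b * q) N + poch q c N)
          ≈⟨ rhsSum-step b N ⟨
        rhsSum b (suc N) ∎

      signedIndexSum≈sum1 : ∀ b N →
        weightedSum signedIndex b N ≈ sum1 N (λ n → qbinom N n * weightedTerm signedIndex b N n)
      signedIndexSum≈sum1 b N = sum0≈sum1 N _
        (solve 1 (λ P → :1 :* (:1 :* :0 :* :1 :* :1 :* :1 :* P) := :0) refl (poch q (b * c * 1#) N))

      rhsSum≈sum1 : ∀ b N → rhsSum b N ≈ sum1 N (λ n → qbinom N n * rhsTerm b N n)
      rhsSum≈sum1 b N = sum0≈sum1 N _ (solve 1 (λ P → :1 :* (P :* :0 :* :1 :* :1) := :0) refl (poch q c N))

  module Summands (q a e : Carrier) (N : ℕ) (e≉0 : ¬ e ≈ 0#)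
                  (qᵏ≉1 : ∀ k → 1 ≤ k → k ≤ N → ¬ (1# - pow q k) ≈ 0#)
                  (aqᵏ≉1 : ∀ k → 1 ≤ k → k ≤ N → ¬ (1# - a * pow q k) ≈ 0#) where
    open QCalculus q public
    open Recurrence (a * e) public

    aq≈bc : a * q ≈ q ÷ e * (a * e)
    aq≈bc = begin
      a * q                    ≈⟨ *-identityʳ _ ⟨
      a * q * 1#               ≈⟨ *-congˡ (inverseʳ e e≉0) ⟨
      a * q * (e * e ⁻¹)
        ≈⟨ solve 4 (λ a q e e⁻¹ → a :* q :* (e :* e⁻¹) := q :* e⁻¹ :* (a :* e)) refl a q e (e ⁻¹) ⟩
      q ÷ e * (a * e)          ∎

    lhsSummand : ∀ n → 1 ≤ n → n ≤ N →
      poch q (a * q) N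
        * (qbin q N n * (signedIndex n * poch q (q ÷ e) n * pow (a * e) n * pow q (tri n)) ÷ poch q (a * q) n)
        ≈ qbinom N n * weightedTerm signedIndex (q ÷ e) N n
    lhsSummand n _ n≤N = begin
      poch q (a * q) N * (qbin q N n * X ÷ poch q (a * q) n)
        ≈⟨ poch-*-÷-poch (a * q) (qbin q N n * X) n≤N (poch≉0 (a * q) n aqᵏ⁺¹≉1) ⟩
      qbin q N n * X * poch q (a * q * pow q n) (N ∸ n)
        ≈⟨ *-cong (*-congʳ (qbin≈qbinom qᵏ≉1 n≤N)) (poch-cong (N ∸ n) (*-congʳ aq≈bc)) ⟩
      qbinom N n * X * poch q (q ÷ e * (a * e) * pow q n) (N ∸ n)
        ≈⟨ *-assoc _ _ _ ⟩
      qbinom N n * weightedTerm signedIndex (q ÷ e) N n ∎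
      where
      X : Carrier
      X = signedIndex n * poch q (q ÷ e) n * pow (a * e) n * pow q (tri n)
      aqᵏ⁺¹≉1 : ∀ k → k < n → ¬ (1# - a * q * pow q k) ≈ 0#
      aqᵏ⁺¹≉1 k k<n eq = aqᵏ≉1 (suc k) (s≤s z≤n) (ℕ.≤-trans k<n n≤N)
                           (trans (sym (+-congˡ (-‿cong (*-assoc a q (pow q k))))) eq)

    rhsSummand : ∀ n → 1 ≤ n → n ≤ N →
      qbinom N n * rhsTerm (q ÷ e) N n
        ≈ qbin q N n * (poch q (a * e) (N ∸ n) * poch q q n * poch q (q ÷ e) n * pow (a * e) n) ÷ (1# - pow q n)
    rhsSummand (suc j) _ n≤N = sym (begin
      qbin q N (suc j) * (P * (Q * V) * B * C) * V ⁻¹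
        ≈⟨ *-congʳ (solve 6 (λ K P Q V B C → K :* (P :* (Q :* V) :* B :* C) := K :* (P :* Q :* B :* C) :* V)
                            refl _ P Q V B C) ⟩
      qbin q N (suc j) * (P * Q * B * C) * V ÷ V
        ≈⟨ *-÷-cancelʳ _ (qᵏ≉1 (suc j) (s≤s z≤n) n≤N) ⟩
      qbin q N (suc j) * rhsTerm (q ÷ e) N (suc j)
        ≈⟨ *-congʳ (qbin≈qbinom qᵏ≉1 n≤N) ⟩
      qbinom N (suc j) * rhsTerm (q ÷ e) N (suc j) ∎)
      where
      P Q V B C : Carrier
      P = poch q (a * e) (N ∸ suc j)
      Q = poch q q j
      V = 1# - pow q (suc j)
      B = poch q (q ÷ e) (suc j)
      C = pow (a * e) (suc j)

theorem5p4 : ∀ {c ℓ : Level} (F : Field c ℓ) →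
    let open Field F
        open FieldOps F
    in (q a e : Carrier) (N : ℕ) →
       ¬ (e ≈ 0#) →
       (∀ k → 1 ≤ k → k ≤ N → ¬ ((1# - pow q k) ≈ 0#)) →
       (∀ k → 1 ≤ k → k ≤ N → ¬ ((1# - a * pow q k) ≈ 0#)) →
       (poch q (a * q) N
         * sum1 N (λ n → qbin q N n
             * (pow (- 1#) (n ∸ 1) * fromℕ n * poch q (q ÷ e) n
                 * pow (a * e) n * pow q (tri n))
             ÷ poch q (a * q) n))
       ≈ sum1 N (λ n → qbin q N n
             * (poch q (a * e) (N ∸ n) * poch q q n * poch q (q ÷ e) n
                 * pow (a * e) n)
             ÷ (1# - pow q n))
theorem5p4 F q a e N e≉0 qᵏ≉1 aqᵏ≉1 = begin
  poch q (a * q) N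
    * sum1 N (λ n → qbin q N n * (signedIndex n * poch q b n * pow c n * pow q (tri n)) ÷ poch q (a * q) n)
    ≈⟨ *-distribˡ-sum1 N _ _ ⟩
  sum1 N (λ n → poch q (a * q) N
    * (qbin q N n * (signedIndex n * poch q b n * pow c n * pow q (tri n)) ÷ poch q (a * q) n))
    ≈⟨ sum1-cong N lhsSummand ⟩
  sum1 N (λ n → qbinom N n * weightedTerm signedIndex b N n)   ≈⟨ signedIndexSum≈sum1 b N ⟨
  weightedSum signedIndex b N                          ≈⟨ signedIndexSum≈rhsSum N b ⟩
  rhsSum b N                                           ≈⟨ rhsSum≈sum1 b N ⟩
  sum1 N (λ n → qbinom N n * rhsTerm b N n)           ≈⟨ sum1-cong N rhsSummand ⟩
  sum1 N (λ n → qbin q N n * (poch q c (N ∸ n) * poch q q n * poch q b n * pow c n) ÷ (1# - pow q n)) ∎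
  where
  open Field F hiding (zero)
  open FieldOps F
  open QSeries F
  open Summands q a e N e≉0 qᵏ≉1 aqᵏ≉1
  open import Relation.Binary.Reasoning.Setoid setoid
  b c : Carrier
  b = q ÷ e
  c = a * e
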